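{- For every graph $G$, $\alpha(G)\le p_2(G)$.
   Context: Graphs are finite and simple, of order $n$; $\alpha(G)$ is the independence number, $N(u)$ the neighbourhood and $d(u)=|N(u)|$ the degree of a vertex $u$. For a vertex $u$, consider all vertices $v\ne u$ not adjacent to $u$ (there are $t-1$ of them, where $t=n-d(u)$), and let $n_2(u)\le n_3(u)\le\cdots\le n_t(u)$ be the nondecreasing sequence of the values $|N(u)\cup N(v)|$ over these vertices $v$. Define $p_2(G):=\max\{k \mid G \text{ has at least } k \text{ vertices } v \text{ with } n_k(v)\le n-k\}$, where for a vertex $v$ the condition $n_k(v)\le n-k$ with $k\ge 2$ requires $k\le n-d(v)$ (so that $n_k(v)$ is defined), and for $k=1$ the condition is regarded as satisfied by every vertex. -}

module Defs where

open import Data.Bool using (Bool; true; false; not; _∧_; if_then_else_)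
open import Data.Nat using (ℕ; zero; suc; _∸_; _≤ᵇ_; _⊔_)
open import Data.Nat.Properties using (≤-decTotalOrder)
open import Data.Fin using (Fin)
open import Data.Fin.Properties using (_≟_)
open import Data.Fin.Subset using (Subset; _∪_; ∣_∣; _∈_)
open import Data.List using (List; []; _∷_; map; filterᵇ; allFin; upTo; length; foldr)
open import Data.Maybe using (Maybe; just; nothing)
open import Data.Vec using (tabulate)
open import Relation.Nullary.Decidable using (⌊_⌋)
open import Relation.Binary.PropositionalEquality using (_≡_)
import Data.List.Sort

record Graph (n : ℕ) : Set where
  field
    adj    : Fin n → Fin n → Bool
    sym    : ∀ u v → adj u v ≡ adj v u
    irrefl : ∀ u → adj u u ≡ false
open Graph public

module _ {n : ℕ} (G : Graph n) where

  N : Fin n → Subset n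
  N u = tabulate (adj G u)

  -- the vertices v ≠ u not adjacent to u (there are t - 1 of them, t = n - d(u))
  nonNeighbours : Fin n → List (Fin n)
  nonNeighbours u = filterᵇ (λ v → not (adj G u v) ∧ not ⌊ u ≟ v ⌋) (allFin n)

  -- the nondecreasing sequence n₂(u) ≤ n₃(u) ≤ … ≤ nₜ(u) of |N(u) ∪ N(v)|
  nseq : Fin n → List ℕ
  nseq u = Data.List.Sort.sort ≤-decTotalOrder
             (map (λ v → ∣ N u ∪ N v ∣) (nonNeighbours u))

nth : List ℕ → ℕ → Maybe ℕ
nth []       _       = nothing
nth (x ∷ xs) zero    = just x
nth (x ∷ xs) (suc i) = nth xs i

module _ {n : ℕ} (G : Graph n) where

  -- the condition  n_k(v) ≤ n - k ; for k ≤ 1 it holds for every vertex,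
  -- for k ≥ 2 it requires n_k(v) to be defined (k ≤ n - d(v)).
  -- n_k(v) is the (k-2)-th (0-based) entry of nseq v.
  cond : ℕ → Fin n → Bool
  cond zero          v = true
  cond (suc zero)    v = true
  cond (suc (suc i)) v with nth (nseq G v) i
  ... | just x  = x ≤ᵇ (n ∸ suc (suc i))
  ... | nothing = false

  count : ℕ → ℕ
  count k = length (filterᵇ (cond k) (allFin n))

  -- p₂(G) = max { k | G has at least k vertices v with n_k(v) ≤ n - k }
  -- (k ranges over 0..n; no k > n can qualify since there are only n vertices)
  p₂ : ℕ
  p₂ = foldr _⊔_ 0 (map (λ k → if k ≤ᵇ count k then k else 0) (upTo (suc n)))

  Independent : Subset n → Set
  Independent S = ∀ u v → u ∈ S → v ∈ S → adj G u v ≡ false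

-- Let S be independent with |S| = k ≥ 2 and v ∈ S. For each of the k - 1 other vertices w ∈ S,
-- w is a non-neighbour of v and N(v) ∪ N(w) avoids S, so |N(v) ∪ N(w)| ≤ n - k. Hence at least
-- k - 1 entries of the sorted sequence n₂(v) ≤ n₃(v) ≤ … are at most n - k, in particular
-- n_k(v) ≤ n - k. Every vertex of S thus satisfies the condition for k, so p₂(G) ≥ k.
module Submission where

open import Defs
open import Data.Nat using (ℕ; _≤_)
open import Data.Fin.Subset using (Subset; ∣_∣)

open import Data.Bool using (Bool; true; false; not; _∧_; T; T?; if_then_else_)
open import Data.Bool.Properties using (T-≡; T-∧; T-not-≡)
open import Data.Fin using (Fin; zero; suc)
open import Data.Fin.Properties using (_≟_)
open import Data.Fin.Subset using (_∈_; _⊆_; _∪_; _∩_; ∁; ⁅_⁆)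
open import Data.Fin.Subset.Properties
  using ( p⊆q⇒∣p∣≤∣q∣; ∣∁p∣≡n∸∣p∣; ∣p∣≤n; x∈∁p⇒x∉p; x∉p⇒x∈∁p; x∈p∪q⁺; x∈p∪q⁻; x∈p∩q⁺; x∈p∩q⁻
        ; ∪-identityʳ; x∈⁅x⁆; x≢y⇒x∉⁅y⁆)
open import Data.List using (List; []; _∷_; map; filterᵇ; allFin; upTo; length; foldr; tabulate)
open import Data.List.Properties using (foldr-preservesᵒ; filter-none)
open import Data.List.Membership.Propositional.Properties using (∈-upTo⁺)
import Data.List.Relation.Unary.All as All
import Data.List.Relation.Unary.Any as Any
import Data.List.Relation.Unary.Any.Properties as Any
import Data.List.Relation.Unary.Linked as Linked
open import Data.List.Relation.Unary.Linked using (Linked)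
open import Data.List.Relation.Unary.Linked.Properties using (Linked⇒All)
open import Data.List.Relation.Binary.Permutation.Propositional using (_↭_)
open import Data.List.Relation.Binary.Permutation.Propositional.Properties using (↭-length; filter-↭)
open import Data.Maybe using (just)
open import Data.Nat using (zero; suc; pred; _∸_; _<_; _≤ᵇ_; _⊔_; z≤n; s≤s; s≤s⁻¹; _≤?_)
open import Data.Nat.Properties
  using ( ≤-refl; ≤-trans; <⇒≤; n≤1+n; m≤n⇒m≤1+n; pred-mono-≤; ≤⇒≤ᵇ; ≤ᵇ⇒≤
        ; m≤n⇒m≤n⊔o; m≤n⇒m≤o⊔n; ≤-decTotalOrder; module ≤-Reasoning)
open import Data.List.Sort ≤-decTotalOrder using (sort-↭; sort-↗)
open import Data.Product using (∃; _×_; _,_; proj₁; proj₂)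
open import Data.Sum using (inj₁; inj₂; [_,_])
open import Data.Vec using ([]; _∷_; here; there)
open import Data.Vec.Properties using ([]=⇒lookup; lookup∘tabulate)
open import Function using (_∘_; id)
open import Function.Bundles using (Equivalence)
open import Relation.Nullary using (yes; no; contradiction)
open import Relation.Nullary.Decidable using (⌊_⌋; fromWitnessFalse)
open import Relation.Binary.PropositionalEquality as ≡ using (_≡_; _≢_; refl; cong; subst)

private
  variable
    A B : Set
    n : ℕ

-- Stated for tabulate f (allFin n is tabulate id) so that the induction on n goes through.
∣p∣≤#filter-tabulate : (p : Subset n) (f : Fin n → A) (Q : A → Bool) →
  (∀ {i} → i ∈ p → T (Q (f i))) → ∣ p ∣ ≤ length (filterᵇ Q (tabulate f))
∣p∣≤#filter-tabulate [] f Q p⊆Q = z≤n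
∣p∣≤#filter-tabulate (true ∷ p) f Q p⊆Q with Q (f zero) | p⊆Q here
... | true | _ = s≤s (∣p∣≤#filter-tabulate p (f ∘ suc) Q (p⊆Q ∘ there))
∣p∣≤#filter-tabulate (false ∷ p) f Q p⊆Q with Q (f zero)
... | true  = m≤n⇒m≤1+n (∣p∣≤#filter-tabulate p (f ∘ suc) Q (p⊆Q ∘ there))
... | false = ∣p∣≤#filter-tabulate p (f ∘ suc) Q (p⊆Q ∘ there)

∣p∪⁅x⁆∣≤1+∣p∣ : (p : Subset n) (x : Fin n) → ∣ p ∪ ⁅ x ⁆ ∣ ≤ suc ∣ p ∣
∣p∪⁅x⁆∣≤1+∣p∣ (true  ∷ p) zero    rewrite ∪-identityʳ p = n≤1+n _
∣p∪⁅x⁆∣≤1+∣p∣ (false ∷ p) zero    rewrite ∪-identityʳ p = ≤-refl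
∣p∪⁅x⁆∣≤1+∣p∣ (true  ∷ p) (suc x) = s≤s (∣p∪⁅x⁆∣≤1+∣p∣ p x)
∣p∪⁅x⁆∣≤1+∣p∣ (false ∷ p) (suc x) = ∣p∪⁅x⁆∣≤1+∣p∣ p x

∣p∣≤1+∣p∩∁⁅x⁆∣ : (p : Subset n) (x : Fin n) → ∣ p ∣ ≤ suc ∣ p ∩ ∁ ⁅ x ⁆ ∣
∣p∣≤1+∣p∩∁⁅x⁆∣ p x = ≤-trans (p⊆q⇒∣p∣≤∣q∣ p⊆p∩∁⁅x⁆∪⁅x⁆) (∣p∪⁅x⁆∣≤1+∣p∣ (p ∩ ∁ ⁅ x ⁆) x)
  where
  p⊆p∩∁⁅x⁆∪⁅x⁆ : p ⊆ p ∩ ∁ ⁅ x ⁆ ∪ ⁅ x ⁆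
  p⊆p∩∁⁅x⁆∪⁅x⁆ {i} i∈p with i ≟ x
  ... | yes refl = x∈p∪q⁺ (inj₂ (x∈⁅x⁆ x))
  ... | no  i≢x  = x∈p∪q⁺ (inj₁ (x∈p∩q⁺ (i∈p , x∉p⇒x∈∁p (x≢y⇒x∉⁅y⁆ i≢x))))

x∈p∩∁⁅y⁆⇒x≢y : ∀ {x y} (p : Subset n) → x ∈ p ∩ ∁ ⁅ y ⁆ → x ≢ y
x∈p∩∁⁅y⁆⇒x≢y {y = y} p x∈p∩∁⁅y⁆ refl =
  x∈∁p⇒x∉p (proj₂ (x∈p∩q⁻ p (∁ ⁅ y ⁆) x∈p∩∁⁅y⁆)) (x∈⁅x⁆ y)

length-filterᵇ-map-filterᵇ : (P : A → Bool) (R : B → Bool) (g : A → B) (xs : List A) →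
  length (filterᵇ R (map g (filterᵇ P xs))) ≡ length (filterᵇ (λ x → P x ∧ R (g x)) xs)
length-filterᵇ-map-filterᵇ P R g [] = refl
length-filterᵇ-map-filterᵇ P R g (x ∷ xs) with P x
... | false = length-filterᵇ-map-filterᵇ P R g xs
... | true with R (g x)
...   | true  = cong suc (length-filterᵇ-map-filterᵇ P R g xs)
...   | false = length-filterᵇ-map-filterᵇ P R g xs

#atMost : ℕ → List ℕ → ℕ
#atMost b xs = length (filterᵇ (_≤ᵇ b) xs)

#atMost-↭ : ∀ b {xs ys} → xs ↭ ys → #atMost b xs ≡ #atMost b ys
#atMost-↭ b = ↭-length ∘ filter-↭ _

-- In a sorted list the entries that are at most b form an initial segment.
nth-sorted-≤ : ∀ b {xs} i → Linked _≤_ xs → i < #atMost b xs →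
  ∃ λ x → nth xs i ≡ just x × T (x ≤ᵇ b)
nth-sorted-≤ b {y ∷ ys} zero sorted 0<# with y ≤? b
... | yes y≤b = y , refl , ≤⇒≤ᵇ y≤b
... | no  y≰b = contradiction (subst (0 <_) (cong length none≤b) 0<#) (λ ())
  where
  none≤b : filterᵇ (_≤ᵇ b) (y ∷ ys) ≡ []
  none≤b = filter-none (T? ∘ (_≤ᵇ b))
    (All.map (λ y≤z z≤b → y≰b (≤-trans y≤z (≤ᵇ⇒≤ _ _ z≤b))) (Linked⇒All ≤-trans ≤-refl sorted))
nth-sorted-≤ b {y ∷ ys} (suc i) sorted i<# with y ≤ᵇ b
... | true  = nth-sorted-≤ b i (Linked.tail sorted) (s≤s⁻¹ i<#)
... | false = nth-sorted-≤ b i (Linked.tail sorted) (<⇒≤ i<#)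

k≤foldr-⊔ : ∀ {k} (xs : List ℕ) → Any.Any (k ≤_) xs → k ≤ foldr _⊔_ 0 xs
k≤foldr-⊔ xs k≤x∈xs =
  foldr-preservesᵒ (λ x y → [ m≤n⇒m≤n⊔o y , m≤n⇒m≤o⊔n x ]) 0 xs (inj₂ k≤x∈xs)

module _ {n : ℕ} (G : Graph n) where

  ∈N⇒adj : ∀ {u i} → i ∈ N G u → adj G u i ≡ true
  ∈N⇒adj {u} {i} i∈Nu = ≡.trans (≡.sym (lookup∘tabulate (adj G u) i)) ([]=⇒lookup i∈Nu)

  #atMost⇒cond : ∀ k v → pred k ≤ #atMost (n ∸ k) (nseq G v) → T (cond G k v)
  #atMost⇒cond zero          v _ = _
  #atMost⇒cond (suc zero)    v _ = _
  #atMost⇒cond (suc (suc i)) v i<# with nth-sorted-≤ (n ∸ suc (suc i)) i (sort-↗ _) i<#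
  ... | x , nth≡x , x≤b rewrite nth≡x = x≤b

  p₂-≥ : ∀ k → k ≤ n → k ≤ count G k → k ≤ p₂ G
  p₂-≥ k k≤n k≤#k =
    k≤foldr-⊔ (map candidate (upTo (suc n)))
      (Any.map⁺ (Any.map (λ { refl → k≤candidate }) (∈-upTo⁺ (s≤s k≤n))))
    where
    candidate : ℕ → ℕ
    candidate j = if j ≤ᵇ count G j then j else 0
    k≤candidate : k ≤ candidate k
    k≤candidate rewrite Equivalence.to T-≡ (≤⇒≤ᵇ k≤#k) = ≤-refl

  module _ {S : Subset n} (indep : Independent G S) where

    N⊆∁S : ∀ {u} → u ∈ S → N G u ⊆ ∁ S
    N⊆∁S u∈S i∈Nu = x∉p⇒x∈∁p λ i∈S →
      contradiction (≡.trans (≡.sym (∈N⇒adj i∈Nu)) (indep _ _ u∈S i∈S)) λ ()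

    ∣N∪N∣≤n∸∣S∣ : ∀ {u w} → u ∈ S → w ∈ S → ∣ N G u ∪ N G w ∣ ≤ n ∸ ∣ S ∣
    ∣N∪N∣≤n∸∣S∣ u∈S w∈S = subst (_ ≤_) (∣∁p∣≡n∸∣p∣ S)
      (p⊆q⇒∣p∣≤∣q∣ λ i∈ → [ N⊆∁S u∈S , N⊆∁S w∈S ] (x∈p∪q⁻ _ _ i∈))

    pred∣S∣≤#atMost-nseq : ∀ {v} → v ∈ S → pred ∣ S ∣ ≤ #atMost (n ∸ ∣ S ∣) (nseq G v)
    pred∣S∣≤#atMost-nseq {v} v∈S = begin
      pred ∣ S ∣                 ≤⟨ pred-mono-≤ (∣p∣≤1+∣p∩∁⁅x⁆∣ S v) ⟩
      ∣ S ∩ ∁ ⁅ v ⁆ ∣            ≤⟨ ∣p∣≤#filter-tabulate _ id _ small-union ⟩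
      length (filterᵇ (λ w → nonNeighbour w ∧ small (g w)) (allFin n))
        ≡⟨ length-filterᵇ-map-filterᵇ nonNeighbour small g (allFin n) ⟨
      #atMost (n ∸ ∣ S ∣) (map g (nonNeighbours G v))
        ≡⟨ #atMost-↭ _ (sort-↭ _) ⟨
      #atMost (n ∸ ∣ S ∣) (nseq G v) ∎
      where
      open ≤-Reasoning
      g : Fin n → ℕ
      g w = ∣ N G v ∪ N G w ∣
      nonNeighbour : Fin n → Bool
      nonNeighbour w = not (adj G v w) ∧ not ⌊ v ≟ w ⌋
      small : ℕ → Bool
      small = _≤ᵇ n ∸ ∣ S ∣
      small-union : ∀ {w} → w ∈ S ∩ ∁ ⁅ v ⁆ → T (nonNeighbour w ∧ small (g w))
      small-union {w} w∈S∖v = Equivalence.from T-∧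
        ( Equivalence.from T-∧ ( Equivalence.from T-not-≡ (indep v w v∈S w∈S)
                               , fromWitnessFalse (x∈p∩∁⁅y⁆⇒x≢y S w∈S∖v ∘ ≡.sym))
        , ≤⇒≤ᵇ (∣N∪N∣≤n∸∣S∣ v∈S w∈S))
        where
        w∈S : w ∈ S
        w∈S = proj₁ (x∈p∩q⁻ S _ w∈S∖v)

    ∈S⇒cond : ∀ {v} → v ∈ S → T (cond G ∣ S ∣ v)
    ∈S⇒cond v∈S = #atMost⇒cond ∣ S ∣ _ (pred∣S∣≤#atMost-nseq v∈S)

proposition3 : (n : ℕ) (G : Graph n) (S : Subset n) → Independent G S → ∣ S ∣ ≤ p₂ G
proposition3 n G S indep =
  p₂-≥ G ∣ S ∣ (∣p∣≤n S) (∣p∣≤#filter-tabulate S id (cond G ∣ S ∣) (∈S⇒cond G indep))
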